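{- Let $\Gamma\vdash A$ be a normalized LJB-sequent. Then every scheme $\pi$ such that $\Gamma\vdash\pi:A$ is derivable in LJB with schemes is generated by the scheme grammar from the non-terminal $s_{\Gamma\vdash A}$.
   Context: Formulas of minimal predicate logic are built from atomic formulas with $\to$ and $\forall$. An LJB-context is a finite multiset of items; an item is a formula or an expression $[\Gamma]_V$ with $V$ a finite set of term variables (bound by the bracket) and $\Gamma$ an LJB-context. An LJB-sequent is $\Gamma\vdash A$; formulas are not taken modulo $\alpha$-equivalence. It is normalized if all its bound variables (by quantifiers or brackets) are pairwise distinct and distinct from its free variables. Cleaning rules (applicable anywhere, also inside brackets): $[I,\Gamma]_V\to I,[\Gamma]_V$ if $FV(I)\cap V=\emptyset$; $[\ ]_V\to\emptyset$; $I,I\to I$; $\Gamma{\downarrow}$ is the normal form of $\Gamma$ obtained by a fixed deterministic strategy. A fixed injective map assigns to each formula $C$ a proof variable, its canonical variable. LJB with schemes: (L$\to$) if $\Gamma=\Gamma_1,[\Gamma_2,[\dots\Gamma_{i-1},[\Gamma_i,A_1\to\dots\to A_n\to P]_{V_{i-1}}\dots]_{V_2}]_{V_1}$ ($i\ge 1$), $P$ atomic with no free variable in $V_1\cup\dots\cup V_{i-1}$, $\Gamma^*=([\dots[[\Gamma_1]_{V_1},\Gamma_2]_{V_2},\dots,\Gamma_{i-1}]_{V_{i-1}},\Gamma_i,A_1\to\dots\to A_n\to P)$, and $\Gamma^*{\downarrow}\vdash\pi_j:A_j$ for all $j$, then $\Gamma\vdash(\alpha\,\pi_1\dots\pi_n):P$,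 $\alpha$ the canonical variable of $A_1\to\dots\to A_n\to P$; (R$\forall$) if $[\Gamma]_V{\downarrow}\vdash\pi:A$ with $V$ the set of all variables bound in $\forall x\,A$ (including $x$), then $\Gamma\vdash\lambda x\,\pi:\forall x\,A$; (R$\to$) if $(\Gamma,A){\downarrow}\vdash\pi:B$ then $\Gamma\vdash\lambda\alpha{:}A\,\pi:A\to B$, $\alpha$ the canonical variable of $A$. Scheme grammar: one non-terminal $s_S$ for each LJB-sequent $S$ reachable from $\Gamma\vdash A$, with productions $s_{\Gamma\vdash P}\to(\alpha\,s_{\Gamma^*{\downarrow}\vdash A_1}\dots s_{\Gamma^*{\downarrow}\vdash A_n})$ for every decomposition of $\Gamma$ and $\alpha$ as in (L$\to$); $s_{\Gamma\vdash\forall xA}\to\lambda x\,s_{[\Gamma]_V{\downarrow}\vdash A}$ ($V$ as in (R$\forall$)); $s_{\Gamma\vdash A\to B}\to\lambda\alpha{:}A\,s_{(\Gamma,A){\downarrow}\vdash B}$ ($\alpha$ canonical for $A$). A scheme generated in $s_S$ is a terminal word derivable from $s_S$. -}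

module Defs where

open import Data.Nat using (ℕ; _≡ᵇ_)
open import Data.Bool using (Bool; true; false; not; _∨_)
open import Data.List using (List; []; _∷_; _++_; [_]; filterᵇ; deduplicate)
open import Data.List.Membership.Propositional using (_∈_; _∉_)
open import Data.List.Relation.Unary.All using (All)
open import Data.List.Relation.Unary.Unique.Propositional using (Unique)
open import Data.List.Relation.Binary.Pointwise using (Pointwise)
open import Data.Product using (_×_; _,_; Σ; ∃)
open import Data.Nat.Properties using (_≟_)
open import Relation.Nullary using (¬_)
open import Relation.Binary.PropositionalEquality using (_≡_)
open import Relation.Binary.Construct.Closure.ReflexiveTransitive using (Star)
open import Function.Definitions using (Injective)

TVar : Set
TVar = ℕ

PVar : Set
PVar = ℕ

data Term : Set where
  var : TVar → Term
  fun : ℕ → List Term → Term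

-- formulas are built from atomic formulas with → and ∀ (NOT modulo α)
data Formula : Set where
  atom : ℕ → List Term → Formula
  _⇒_  : Formula → Formula → Formula
  all  : TVar → Formula → Formula

infixr 5 _⇒_

arrows : List Formula → Formula → Formula
arrows []       B = B
arrows (A ∷ As) B = A ⇒ arrows As B

elem : ℕ → List ℕ → Bool
elem x []       = false
elem x (y ∷ ys) = (x ≡ᵇ y) ∨ elem x ys

remove : List ℕ → List ℕ → List ℕ
remove V = filterᵇ (λ x → not (elem x V))

mutual
  FVT : Term → List TVar
  FVT (var x)    = x ∷ []
  FVT (fun f ts) = FVTs ts

  FVTs : List Term → List TVar
  FVTs []       = []
  FVTs (t ∷ ts) = FVT t ++ FVTs ts

FVF : Formula → List TVar
FVF (atom p ts) = FVTs ts
FVF (A ⇒ B)     = FVF A ++ FVF B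
FVF (all x A)   = remove (x ∷ []) (FVF A)

BVF : Formula → List TVar
BVF (atom p ts) = []
BVF (A ⇒ B)     = BVF A ++ BVF B
BVF (all x A)   = x ∷ BVF A

-- LJB-contexts: finite multisets of items, an item being a formula or
-- a bracket [Γ]_V (V a finite set of term variables, given as a list).
-- Multisets are represented by lists, considered up to _≋_ below.

mutual
  data Item : Set where
    fm : Formula → Item
    br : List TVar → List Item → Item

Ctx : Set
Ctx = List Item

mutual
  FVI : Item → List TVar
  FVI (fm A)   = FVF A
  FVI (br V Γ) = remove V (FVC Γ)

  FVC : Ctx → List TVar
  FVC []       = []
  FVC (I ∷ Γ)  = FVI I ++ FVC Γ

mutual
  -- a bracket binds each variable of the set V once
  BVI : Item → List TVar
  BVI (fm A)   = BVF A
  BVI (br V Γ) = deduplicate _≟_ V ++ BVC Γ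

  BVC : Ctx → List TVar
  BVC []      = []
  BVC (I ∷ Γ) = BVI I ++ BVC Γ

SetEq : List TVar → List TVar → Set
SetEq V W = ∀ x → (x ∈ V → x ∈ W) × (x ∈ W → x ∈ V)

Disjoint : List TVar → List TVar → Set
Disjoint xs ys = ∀ x → x ∈ xs → x ∉ ys

mutual
  data _≈I_ : Item → Item → Set where
    fm≈ : ∀ {A} → fm A ≈I fm A
    br≈ : ∀ {V W Γ Δ} → SetEq V W → Γ ≋ Δ → br V Γ ≈I br W Δ

  data _≋_ : Ctx → Ctx → Set where
    []≋    : [] ≋ []
    cons≋  : ∀ {I J Γ Δ} → I ≈I J → Γ ≋ Δ → (I ∷ Γ) ≋ (J ∷ Δ)
    swap≋  : ∀ {I J Γ} → (I ∷ J ∷ Γ) ≋ (J ∷ I ∷ Γ)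
    trans≋ : ∀ {Γ Δ Θ} → Γ ≋ Δ → Δ ≋ Θ → Γ ≋ Θ

infix 4 _⊢_

record Sequent : Set where
  constructor _⊢_
  field
    ctx  : Ctx
    goal : Formula

BVS : Sequent → List TVar
BVS (Γ ⊢ A) = BVC Γ ++ BVF A

FVS : Sequent → List TVar
FVS (Γ ⊢ A) = FVC Γ ++ FVF A

Normalized : Sequent → Set
Normalized S = Unique (BVS S) × Disjoint (BVS S) (FVS S)

data Step : Ctx → Ctx → Set where
  extrude : ∀ {Γ V I Δ Θ} → Γ ≋ (br V (I ∷ Δ) ∷ Θ) → Disjoint (FVI I) V →
            Step Γ (I ∷ br V Δ ∷ Θ)
  drop    : ∀ {Γ V Θ} → Γ ≋ (br V [] ∷ Θ) → Step Γ Θ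
  dup     : ∀ {Γ I J Θ} → Γ ≋ (I ∷ J ∷ Θ) → I ≈I J → Step Γ (I ∷ Θ)
  inside  : ∀ {Γ V Δ Δ' Θ} → Γ ≋ (br V Δ ∷ Θ) → Step Δ Δ' →
            Step Γ (br V Δ' ∷ Θ)

CleanNormal : Ctx → Set
CleanNormal Γ = ∀ Δ → ¬ Step Γ Δ

-- The fixed data of the paper: a deterministic cleaning strategy Γ ↦ Γ↓
-- (producing a normal form of Γ) and an injective canonical-variable map.
record Setting : Set where
  infix 10 _↓
  field
    _↓          : Ctx → Ctx
    ↓-reduces   : ∀ Γ → Star Step Γ (Γ ↓)
    ↓-normal    : ∀ Γ → CleanNormal (Γ ↓)
    canon       : Formula → PVar
    canon-inj   : Injective _≡_ _≡_ canon

data Scheme : Set where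
  app  : PVar → List Scheme → Scheme
  lamT : TVar → Scheme → Scheme
  lamP : PVar → Formula → Scheme → Scheme

-- Decompositions Γ = Γ₁,[Γ₂,[…Γ_{i-1},[Γᵢ, F]_{V_{i-1}}…]_{V₂}]_{V₁}
-- layers = (Γ₁,V₁) ∷ … ∷ (Γ_{i-1},V_{i-1}) ∷ [],  inner = Γᵢ.

Layers : Set
Layers = List (Ctx × List TVar)

plug : Layers → Ctx → Ctx
plug []              Δ = Δ
plug ((Γ , V) ∷ ls)  Δ = Γ ++ [ br V (plug ls Δ) ]

-- [ … [[Γ₁]_{V₁},Γ₂]_{V₂}, …, Γ_{i-1}]_{V_{i-1}}
outer : Ctx → Layers → Ctx
outer acc []             = acc
outer acc ((Γ , V) ∷ ls) = outer [ br V (acc ++ Γ) ] ls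

star : Layers → Ctx → Formula → Ctx
star ls inner F = outer [] ls ++ inner ++ [ fm F ]

layerVars : Layers → List TVar
layerVars []             = []
layerVars ((Γ , V) ∷ ls) = V ++ layerVars ls

-- the side conditions of (L→): Γ decomposes as above with
-- F = A₁ → … → Aₙ → P, P = atom p ts atomic with no free variable in V₁∪…∪V_{i-1}
LSplit : Ctx → Layers → Ctx → List Formula → ℕ → List Term → Set
LSplit Γ ls inner As p ts =
  (Γ ≋ plug ls (inner ++ [ fm (arrows As (atom p ts)) ])) ×
  Disjoint (FVTs ts) (layerVars ls)

module Calculus (St : Setting) where
  open Setting St

  data Deriv : Ctx → Formula → Scheme → Set where
    L⇒ : ∀ {Γ ls inner As p ts πs} → LSplit Γ ls inner As p ts →
         Pointwise (λ A π → Deriv (star ls inner (arrows As (atom p ts)) ↓) A π) As πs →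
         Deriv Γ (atom p ts) (app (canon (arrows As (atom p ts))) πs)
    R∀ : ∀ {Γ x A π} →
         Deriv ([ br (x ∷ BVF A) Γ ] ↓) A π →
         Deriv Γ (all x A) (lamT x π)
    R⇒ : ∀ {Γ A B π} →
         Deriv ((Γ ++ [ fm A ]) ↓) B π →
         Deriv Γ (A ⇒ B) (lamP (canon A) A π)

  -- sequents reachable from S₀ (the non-terminals of the grammar)
  data Reach (S₀ : Sequent) : Sequent → Set where
    here  : Reach S₀ S₀
    viaL  : ∀ {Γ ls inner As p ts A} → Reach S₀ (Γ ⊢ atom p ts) →
            LSplit Γ ls inner As p ts → A ∈ As →
            Reach S₀ (star ls inner (arrows As (atom p ts)) ↓ ⊢ A)
    via∀  : ∀ {Γ x A} → Reach S₀ (Γ ⊢ all x A) →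
            Reach S₀ ([ br (x ∷ BVF A) Γ ] ↓ ⊢ A)
    via⇒  : ∀ {Γ A B} → Reach S₀ (Γ ⊢ A ⇒ B) →
            Reach S₀ ((Γ ++ [ fm A ]) ↓ ⊢ B)

  -- Gen S₀ S π : the terminal word π is derivable from the non-terminal s_S
  -- of the grammar associated with S₀
  data Gen (S₀ : Sequent) : Sequent → Scheme → Set where
    prodL : ∀ {Γ ls inner As p ts πs} → Reach S₀ (Γ ⊢ atom p ts) →
            LSplit Γ ls inner As p ts →
            Pointwise (λ A π → Gen S₀ (star ls inner (arrows As (atom p ts)) ↓ ⊢ A) π) As πs →
            Gen S₀ (Γ ⊢ atom p ts) (app (canon (arrows As (atom p ts))) πs)
    prod∀ : ∀ {Γ x A π} → Reach S₀ (Γ ⊢ all x A) →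
            Gen S₀ ([ br (x ∷ BVF A) Γ ] ↓ ⊢ A) π →
            Gen S₀ (Γ ⊢ all x A) (lamT x π)
    prod⇒ : ∀ {Γ A B π} → Reach S₀ (Γ ⊢ A ⇒ B) →
            Gen S₀ ((Γ ++ [ fm A ]) ↓ ⊢ B) π →
            Gen S₀ (Γ ⊢ A ⇒ B) (lamP (canon A) A π)

{-# OPTIONS --safe #-}
module Submission where

-- The productions of the scheme grammar mirror the rules of LJB one for one, so a
-- derivation of Γ ⊢ π : A is translated rule by rule into a derivation of π from
-- s_{Γ⊢A}. The only invariant to carry along is that every sequent met on the way
-- is reachable from the root sequent, which is exactly how the premisses of the
-- rules are obtained from their conclusions.

open import Defs
open import Data.List.Relation.Binary.Pointwise using (Pointwise; []; _∷_)
open import Data.List.Relation.Binary.Subset.Propositional using (_⊆_)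
open import Data.List.Relation.Binary.Subset.Propositional.Properties using (⊆-refl)
open import Data.List.Relation.Unary.Any using (here; there)
open import Relation.Binary.PropositionalEquality using (refl)

module _ (St : Setting) (S₀ : Sequent) where
  open Setting St
  open Calculus St

  mutual
    Deriv⇒Gen : ∀ {Γ A π} → Reach S₀ (Γ ⊢ A) → Deriv Γ A π → Gen S₀ (Γ ⊢ A) π
    Deriv⇒Gen r (L⇒ {ls = ls} {inner} split ds) =
      prodL {ls = ls} {inner} r split (Derivs⇒Gens {ls = ls} {inner} r split ⊆-refl ds)
    Deriv⇒Gen r (R∀ d) = prod∀ r (Deriv⇒Gen (via∀ r) d)
    Deriv⇒Gen r (R⇒ d) = prod⇒ r (Deriv⇒Gen (via⇒ r) d)

    -- Bs ranges over the suffixes of the premiss list As, so that recursion stays structural.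
    Derivs⇒Gens : ∀ {Γ ls inner As p ts Bs πs} → Reach S₀ (Γ ⊢ atom p ts) →
      LSplit Γ ls inner As p ts → Bs ⊆ As →
      Pointwise (λ B π → Deriv (star ls inner (arrows As (atom p ts)) ↓) B π) Bs πs →
      Pointwise (λ B π → Gen S₀ (star ls inner (arrows As (atom p ts)) ↓ ⊢ B) π) Bs πs
    Derivs⇒Gens r split Bs⊆As [] = []
    Derivs⇒Gens {ls = ls} {inner} r split Bs⊆As (d ∷ ds) =
      Deriv⇒Gen (viaL {ls = ls} {inner} r split (Bs⊆As (here refl))) d ∷
      Derivs⇒Gens {ls = ls} {inner} r split (λ B∈ → Bs⊆As (there B∈)) ds

-- Normalization is a standing assumption of the paper; this direction does not use it.
proposition3 : (St : Setting) (Γ : Ctx) (A : Formula) →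
    Normalized (Γ ⊢ A) →
    ∀ π → Calculus.Deriv St Γ A π → Calculus.Gen St (Γ ⊢ A) (Γ ⊢ A) π
proposition3 St Γ A _ π = Deriv⇒Gen St (Γ ⊢ A) Calculus.here
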